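{- Let $K$ be a simplicial complex such that every simplex of $K$ is contained in a maximal simplex of $K$. Let $M$ be the set of maximal simplices of $K$ and let $L_K$ be the poset of non-empty intersections of (non-empty families of) simplices of $M$, ordered by inclusion. Then $K$ has the fixed simplex property if and only if the poset $L_K$ has the fixed point property.
   Context: A simplicial complex $K$ has the fixed simplex property if every simplicial map $f\colon K\to K$ fixes some simplex, i.e. there is a simplex $\sigma$ of $K$ with $f(\sigma)=\sigma$. A poset has the fixed point property if every order-preserving self-map of it has a fixed point. -}

module Defs where

open import Level using (0ℓ) renaming (suc to lsuc)
open import Data.List using (List; []; _∷_; map)
open import Data.List.Membership.Propositional using (_∈_)
open import Data.List.Relation.Binary.Subset.Propositional using (_⊆_)
open import Data.List.Relation.Binary.Subset.Propositional.Properties using (⊆-refl; ⊆-trans)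
open import Data.Product using (Σ; ∃; ∃-syntax; _×_; _,_; proj₁; proj₂)
open import Relation.Binary.PropositionalEquality using (_≡_)
open import Relation.Binary.Bundles using (Poset)
open import Relation.Binary.Structures using (IsPartialOrder; IsPreorder; IsEquivalence)
open import Relation.Nullary using (¬_)
open import Function using (_⇔_)

-- Finite sets of vertices are represented by lists; two lists denote the
-- same set iff each is contained in the other.
_≋_ : {A : Set} → List A → List A → Set
xs ≋ ys = (xs ⊆ ys) × (ys ⊆ xs)

record SimplicialComplex : Set₁ where
  field
    V            : Set
    IsSimplex    : List V → Set
    nonempty     : ∀ {σ} → IsSimplex σ → ¬ (σ ≡ [])
    vertex       : ∀ (v : V) → IsSimplex (v ∷ [])
    down-closed  : ∀ {σ τ} → IsSimplex σ → τ ⊆ σ → ¬ (τ ≡ []) → IsSimplex τ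

module _ (K : SimplicialComplex) where
  open SimplicialComplex K

  IsSimplicialMap : (V → V) → Set
  IsSimplicialMap f = ∀ σ → IsSimplex σ → IsSimplex (map f σ)

  FixesSimplex : (V → V) → List V → Set
  FixesSimplex f σ = IsSimplex σ × (map f σ ≋ σ)

  FixedSimplexProperty : Set
  FixedSimplexProperty =
    ∀ (f : V → V) → IsSimplicialMap f → ∃[ σ ] FixesSimplex f σ

  IsMaximalSimplex : List V → Set
  IsMaximalSimplex σ = IsSimplex σ × (∀ τ → IsSimplex τ → σ ⊆ τ → τ ⊆ σ)

  EverySimplexInMaximal : Set
  EverySimplexInMaximal = ∀ σ → IsSimplex σ → ∃[ m ] (IsMaximalSimplex m × σ ⊆ m)

  -- σ is the (non-empty) intersection of a non-empty family (indexed by an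
  -- arbitrary inhabited type I) of maximal simplices
  IsIntersectionOfMaximal : List V → Set₁
  IsIntersectionOfMaximal σ =
    ¬ (σ ≡ []) ×
    Σ Set λ I → I × Σ (I → List V) λ m →
      (∀ i → IsMaximalSimplex (m i)) × (∀ v → (v ∈ σ) ⇔ (∀ i → v ∈ m i))

  LCarrier : Set₁
  LCarrier = Σ (List V) IsIntersectionOfMaximal

  _≈L_ : LCarrier → LCarrier → Set
  x ≈L y = proj₁ x ≋ proj₁ y

  _≤L_ : LCarrier → LCarrier → Set
  x ≤L y = proj₁ x ⊆ proj₁ y

  L : Poset (lsuc 0ℓ) 0ℓ 0ℓ
  L = record
    { Carrier = LCarrier
    ; _≈_ = _≈L_
    ; _≤_ = _≤L_
    ; isPartialOrder = record
      { isPreorder = record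
        { isEquivalence = record
          { refl = ⊆-refl , ⊆-refl
          ; sym = λ (p , q) → q , p
          ; trans = λ (p , q) (r , s) → ⊆-trans p r , ⊆-trans s q
          }
        ; reflexive = proj₁
        ; trans = ⊆-trans
        }
      ; antisym = λ p q → p , q
      }
    }

FixedPointProperty : ∀ {c ℓ₁ ℓ₂} → Poset c ℓ₁ ℓ₂ → Set _
FixedPointProperty P =
  ∀ (g : Carrier → Carrier) → (∀ {x y} → x ≤ y → g x ≤ g y) → ∃[ x ] (g x ≈ x)
  where open Poset P

module Submission where

-- For a simplicial map f, closing f(x) in L_K gives an order-preserving map
-- on L_K; a fixed point x satisfies f(x) ⊆ x, and a finite set mapped into
-- itself contains a non-empty subset mapped onto itself. Conversely, a
-- monotone g on L_K induces a simplicial map sending v to some vertex of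
-- g(closure of v); a simplex σ fixed by it yields τ = closure of σ with
-- τ ≤ g τ, so the iterates of g at τ form an ascending chain of simplices.
-- Such a chain stabilises, giving a fixed point of g: otherwise picking new
-- vertices w₀, w₁, … along it, the map wₙ ↦ wₙ₊₁ (and anything else ↦ w₀)
-- is simplicial, yet no finite simplex is mapped onto itself by it.

open import Defs
open import Level using (Level; _⊔_; 0ℓ; Lift; lift; lower) renaming (suc to lsuc)
open import Axiom.ExcludedMiddle using (ExcludedMiddle)
open import Axiom.DoubleNegationElimination using (em⇒dne)
open import Function using (_∘_; _⇔_; mk⇔; Equivalence)
open import Data.List using (List; []; _∷_; map; filter; length)
open import Data.List.Membership.Propositional using (_∈_; _∉_)
open import Data.List.Membership.Propositional.Properties using (∈-map⁺; ∈-map⁻; ∈-filter⁺; ∈-filter⁻)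
open import Data.List.Relation.Binary.Subset.Propositional using (_⊆_)
open import Data.List.Relation.Binary.Subset.Propositional.Properties using (⊆-refl; ⊆-trans; map⁺; filter-⊆)
open import Data.List.Relation.Unary.Any as Any using (here; there)
open import Data.List.Properties using (filter-notAll)
open import Data.Product using (∃-syntax; _×_; _,_; proj₁; proj₂)
open import Data.Unit using (⊤; tt)
open import Data.Empty using (⊥-elim)
open import Data.Nat using (ℕ; zero; suc; _≤_; _<_; _≤′_; ≤′-refl; ≤′-step; z≤n; s≤s)
  renaming (_⊔_ to _⊔ℕ_)
open import Data.Nat.Properties using (≤-refl; ≤-trans; ≤⇒≤′; <-cmp; m≤m⊔n; m≤n⊔m)
open import Relation.Binary.Definitions using (tri<; tri≈; tri>)
open import Relation.Binary.PropositionalEquality using (_≡_; refl; sym; cong; subst)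
open import Relation.Nullary using (¬_; yes; no; ¬?)
open import Relation.Nullary.Decidable using (map′)

private
  variable
    a : Level
    A B : Set a

ExcludedMiddle-lower : ∀ b → ExcludedMiddle (a ⊔ b) → ExcludedMiddle a
ExcludedMiddle-lower b em {P} = map′ lower lift (em {Lift b P})

∈⇒nonempty : {x : A} {xs : List A} → x ∈ xs → ¬ xs ≡ []
∈⇒nonempty {xs = []}    ()
∈⇒nonempty {xs = _ ∷ _} _  ()

nonempty⇒∈ : {xs : List A} → ¬ xs ≡ [] → ∃[ x ] x ∈ xs
nonempty⇒∈ {xs = []}    xs≢[] = ⊥-elim (xs≢[] refl)
nonempty⇒∈ {xs = x ∷ _} _     = x , here refl

map-nonempty : (f : A → B) {xs : List A} → ¬ xs ≡ [] → ¬ map f xs ≡ []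
map-nonempty f xs≢[] = ∈⇒nonempty (∈-map⁺ f (proj₂ (nonempty⇒∈ xs≢[])))

map-⊆ : (f : A → B) {xs : List A} {ys : List B} →
        (∀ {x} → x ∈ xs → f x ∈ ys) → map f xs ⊆ ys
map-⊆ f {xs} f∈ys y∈ with ∈-map⁻ f {xs = xs} y∈
... | x , x∈xs , refl = f∈ys x∈xs

module AscendingChain (c : ℕ → List A) (step : ∀ n → c n ⊆ c (suc n)) where

  mono : ∀ {m n} → m ≤ n → c m ⊆ c n
  mono = go ∘ ≤⇒≤′
    where
      go : ∀ {m n} → m ≤′ n → c m ⊆ c n
      go ≤′-refl        = ⊆-refl
      go (≤′-step m≤′n) = ⊆-trans (go m≤′n) (step _)

  finite⊆member : ∀ xs → (∀ {x} → x ∈ xs → ∃[ n ] x ∈ c n) → ∃[ N ] xs ⊆ c N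
  finite⊆member []       _    = 0 , λ ()
  finite⊆member (x ∷ xs) in-c with in-c (here refl) | finite⊆member xs (in-c ∘ there)
  ... | m , x∈cm | N , xs⊆cN = m ⊔ℕ N , λ
    { (here refl) → mono (m≤m⊔n m N) x∈cm
    ; (there y∈)  → mono (m≤n⊔m m N) (xs⊆cN y∈) }

module Classical {A : Set} (em : ExcludedMiddle 0ℓ) where

  ⊈⇒∃∉ : {xs ys : List A} → ¬ xs ⊆ ys → ∃[ x ] (x ∈ xs × x ∉ ys)
  ⊈⇒∃∉ xs⊈ys = dne λ ∄ → xs⊈ys λ x∈xs → dne λ x∉ys → ∄ (_ , x∈xs , x∉ys)
    where dne = em⇒dne em

  invariant⇒∃fixed-subset : (f : A → A) {xs : List A} → ¬ xs ≡ [] → map f xs ⊆ xs →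
                            ∃[ σ ] (¬ σ ≡ [] × σ ⊆ xs × map f σ ≋ σ)
  invariant⇒∃fixed-subset f {xs} = go (suc (length xs)) xs ≤-refl
    where
      -- Removing a vertex outside the image keeps the set invariant and shrinks it.
      go : ∀ n xs → length xs < n → ¬ xs ≡ [] → map f xs ⊆ xs →
           ∃[ σ ] (¬ σ ≡ [] × σ ⊆ xs × map f σ ≋ σ)
      go (suc n) xs (s≤s |xs|≤n) xs≢[] fxs⊆xs with em {xs ⊆ map f xs}
      ... | yes xs⊆fxs = xs , xs≢[] , ⊆-refl , fxs⊆xs , xs⊆fxs
      ... | no xs⊈fxs with ⊈⇒∃∉ xs⊈fxs
      ...   | v , v∈xs , v∉fxs with go n xs′ shorter xs′≢[] fxs′⊆xs′
        where
          ≢v? = λ u → ¬? (em {u ≡ v})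
          xs′ = filter ≢v? xs
          into-xs′ : map f xs ⊆ xs′
          into-xs′ u∈fxs = ∈-filter⁺ ≢v? (fxs⊆xs u∈fxs) λ { refl → v∉fxs u∈fxs }
          fxs′⊆xs′ : map f xs′ ⊆ xs′
          fxs′⊆xs′ = ⊆-trans (map⁺ f (filter-⊆ ≢v? xs)) into-xs′
          xs′≢[] : ¬ xs′ ≡ []
          xs′≢[] = ∈⇒nonempty (into-xs′ (∈-map⁺ f (proj₂ (nonempty⇒∈ xs≢[]))))
          shorter : length xs′ < n
          shorter = ≤-trans (filter-notAll ≢v? xs (Any.map (λ { refl ≢ → ≢ refl }) v∈xs)) |xs|≤n
      ...     | σ , σ≢[] , σ⊆xs′ , fσ≋σ = σ , σ≢[] , ⊆-trans σ⊆xs′ (filter-⊆ _ xs) , fσ≋σ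

  module StrictChain (c : ℕ → List A) (step : ∀ n → c n ⊆ c (suc n))
                     (strict : ∀ n → ¬ c (suc n) ⊆ c n) where
    open AscendingChain c step

    new : ℕ → A
    new n = proj₁ (⊈⇒∃∉ (strict n))

    new∈ : ∀ {m n} → n < m → new n ∈ c m
    new∈ {n = n} n<m = mono n<m (proj₁ (proj₂ (⊈⇒∃∉ (strict n))))

    new∉ : ∀ {m n} → m ≤ n → new n ∉ c m
    new∉ {n = n} m≤n = proj₂ (proj₂ (⊈⇒∃∉ (strict n))) ∘ mono m≤n

    new-injective : ∀ {m n} → new m ≡ new n → m ≡ n
    new-injective {m} {n} eq with <-cmp m n
    ... | tri< m<n _ _ = ⊥-elim (new∉ ≤-refl (subst (_∈ c n) eq (new∈ m<n)))
    ... | tri≈ _ m≡n _ = m≡n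
    ... | tri> _ _ n<m = ⊥-elim (new∉ ≤-refl (subst (_∈ c m) (sym eq) (new∈ n<m)))

    shift : A → A
    shift x with em {∃[ n ] x ≡ new n}
    ... | yes (n , _) = new (suc n)
    ... | no _        = new zero

    shift-new : ∀ n → shift (new n) ≡ new (suc n)
    shift-new n with em {∃[ m ] new n ≡ new m}
    ... | yes (m , eq) = cong (new ∘ suc) (new-injective (sym eq))
    ... | no ∄         = ⊥-elim (∄ (n , refl))

    shift-range : ∀ x → ∃[ n ] shift x ≡ new n
    shift-range x with em {∃[ n ] x ≡ new n}
    ... | yes (n , _) = suc n , refl
    ... | no _        = zero , refl

    shift∈ : ∀ x → ∃[ n ] shift x ∈ c n
    shift∈ x with shift-range x
    ... | n , eq = suc n , subst (_∈ c (suc n)) (sym eq) (new∈ ≤-refl)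

    -- A finite set onto which shift maps lies in some c N, yet it contains
    -- new j for arbitrarily large j.
    no-finite-shift-invariant : ∀ {ρ} → ¬ ρ ≡ [] → ¬ map shift ρ ≋ ρ
    no-finite-shift-invariant {ρ} ρ≢[] (shiftρ⊆ρ , ρ⊆shiftρ) =
      let j , N≤j , newj∈ρ = reach N in new∉ N≤j (ρ⊆cN newj∈ρ)
      where
        ∈ρ⇒new : ∀ {x} → x ∈ ρ → ∃[ n ] x ≡ new n
        ∈ρ⇒new x∈ρ with ∈-map⁻ shift (ρ⊆shiftρ x∈ρ)
        ... | y , _ , refl = shift-range y

        ∈ρ⇒∈c : ∀ {x} → x ∈ ρ → ∃[ n ] x ∈ c n
        ∈ρ⇒∈c x∈ρ with ∈ρ⇒new x∈ρ
        ... | n , refl = suc n , new∈ ≤-refl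

        N = proj₁ (finite⊆member ρ ∈ρ⇒∈c)
        ρ⊆cN = proj₂ (finite⊆member ρ ∈ρ⇒∈c)

        reach : ∀ k → ∃[ j ] (k ≤ j × new j ∈ ρ)
        reach zero with nonempty⇒∈ ρ≢[]
        ... | x , x∈ρ with ∈ρ⇒new x∈ρ
        ...   | j , refl = j , z≤n , x∈ρ
        reach (suc k) with reach k
        ... | j , k≤j , newj∈ρ =
          suc j , s≤s k≤j , shiftρ⊆ρ (subst (_∈ map shift ρ) (shift-new j) (∈-map⁺ shift newj∈ρ))

module _ (em : ExcludedMiddle 0ℓ) (K : SimplicialComplex) where
  open SimplicialComplex K
  open Classical {V} em

  FixedSimplexProperty⇒ascending-chains-stabilise :
    FixedSimplexProperty K → (c : ℕ → List V) → (∀ n → IsSimplex (c n)) →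
    (∀ n → c n ⊆ c (suc n)) → ∃[ n ] c (suc n) ⊆ c n
  FixedSimplexProperty⇒ascending-chains-stabilise fsp c c-simplex step =
    em⇒dne em λ ∄ → let open StrictChain c step (λ n stable → ∄ (n , λ {x} → stable {x}))
                        ρ , ρ-simplex , shiftρ≋ρ = fsp shift (chain-valued⇒simplicial shift∈)
                    in no-finite-shift-invariant (nonempty ρ-simplex) shiftρ≋ρ
    where
      open AscendingChain c step
      chain-valued⇒simplicial : ∀ {h} → (∀ x → ∃[ n ] h x ∈ c n) → IsSimplicialMap K h
      chain-valued⇒simplicial {h} h∈c σ σ-simplex =
        let N , hσ⊆cN = finite⊆member (map h σ) λ y∈ → let x , _ , y≡hx = ∈-map⁻ h y∈
                                                       in subst (λ y → ∃[ n ] y ∈ c n) (sym y≡hx) (h∈c x)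
        in down-closed (c-simplex N) hσ⊆cN (map-nonempty h (nonempty σ-simplex))

  ∣_∣ : LCarrier K → List V
  ∣_∣ = proj₁

  L-simplex : (x : LCarrier K) → IsSimplex ∣ x ∣
  L-simplex (σ , σ≢[] , I , i , m , m-maximal , ∈σ⇔) =
    down-closed (proj₁ (m-maximal i)) (λ v∈σ → Equivalence.to (∈σ⇔ _) v∈σ i) σ≢[]

  maximal∈L : ∀ {m} → IsMaximalSimplex K m → LCarrier K
  maximal∈L {m} m-maximal =
    m , nonempty (proj₁ m-maximal) , ⊤ , tt , (λ _ → m) , (λ _ → m-maximal) ,
    λ v → mk⇔ (λ v∈m _ → v∈m) (λ v∈m → v∈m tt)

  postfixed⇒fixed : FixedSimplexProperty K → (g : LCarrier K → LCarrier K) →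
                    (∀ {x y} → ∣ x ∣ ⊆ ∣ y ∣ → ∣ g x ∣ ⊆ ∣ g y ∣) →
                    ∀ τ → ∣ τ ∣ ⊆ ∣ g τ ∣ → ∃[ x ] ∣ g x ∣ ≋ ∣ x ∣
  postfixed⇒fixed fsp g g-mono τ τ⊆gτ =
    let n , stable = FixedSimplexProperty⇒ascending-chains-stabilise fsp
                       (∣_∣ ∘ iterate) (L-simplex ∘ iterate) ascending
    in iterate n , (λ {v} → stable {v}) , ascending n
    where
      iterate : ℕ → LCarrier K
      iterate zero    = τ
      iterate (suc n) = g (iterate n)

      ascending : ∀ n → ∣ iterate n ∣ ⊆ ∣ iterate (suc n) ∣
      ascending zero    = τ⊆gτ
      ascending (suc n) = g-mono {iterate n} {iterate (suc n)} (ascending n)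

  MaximalAbove : List V → Set
  MaximalAbove σ = ∃[ m ] (IsMaximalSimplex K m × σ ⊆ m)

  InAllMaximalAbove : List V → V → Set
  InAllMaximalAbove σ v = ∀ (M : MaximalAbove σ) → v ∈ proj₁ M

  module _ (esm : EverySimplexInMaximal K) where

    -- The intersection of all maximal simplices containing σ, filtered out of one of them.
    closure : (σ : List V) → IsSimplex σ → List V
    closure σ σ-simplex = filter (λ v → em {InAllMaximalAbove σ v}) (proj₁ (esm σ σ-simplex))

    ∈-closure : ∀ {σ} σ-simplex {v} → v ∈ closure σ σ-simplex ⇔ InAllMaximalAbove σ v
    ∈-closure {σ} σ-simplex =
      mk⇔ (proj₂ ∘ ∈-filter⁻ inAll? {xs = proj₁ (esm σ σ-simplex)})
          (λ ∈all → ∈-filter⁺ inAll? (∈all (esm σ σ-simplex)) ∈all)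
      where inAll? = λ v → em {InAllMaximalAbove σ v}

    ⊆-closure : ∀ {σ} σ-simplex → σ ⊆ closure σ σ-simplex
    ⊆-closure σ-simplex v∈σ = Equivalence.from (∈-closure σ-simplex) λ (_ , _ , σ⊆m) → σ⊆m v∈σ

    closureL : (σ : List V) → IsSimplex σ → LCarrier K
    closureL σ σ-simplex =
      closure σ σ-simplex ,
      ∈⇒nonempty (⊆-closure σ-simplex (proj₂ (nonempty⇒∈ (nonempty σ-simplex)))) ,
      MaximalAbove σ , esm σ σ-simplex , proj₁ , proj₁ ∘ proj₂ , λ _ → ∈-closure σ-simplex

    closure-least : ∀ {σ} σ-simplex (x : LCarrier K) → σ ⊆ ∣ x ∣ → closure σ σ-simplex ⊆ ∣ x ∣
    closure-least σ-simplex (τ , _ , I , _ , m , m-maximal , ∈τ⇔) σ⊆τ v∈ =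
      Equivalence.from (∈τ⇔ _) λ i →
        Equivalence.to (∈-closure σ-simplex) v∈ (m i , m-maximal i , λ u∈σ → Equivalence.to (∈τ⇔ _) (σ⊆τ u∈σ) i)

    FixedPointProperty⇒FixedSimplexProperty : FixedPointProperty (L K) → FixedSimplexProperty K
    FixedPointProperty⇒FixedSimplexProperty fpp f f-simplicial =
      let x , closedImage-x≋x = fpp closedImage (λ {x} {y} → closedImage-mono {x} {y})
          σ , σ≢[] , σ⊆x , fσ≋σ = invariant⇒∃fixed-subset f (proj₁ (proj₂ x))
                                    (⊆-trans (⊆-closure _) (proj₁ closedImage-x≋x))
      in σ , down-closed (L-simplex x) σ⊆x σ≢[] , fσ≋σ
      where
        closedImage : LCarrier K → LCarrier K
        closedImage x = closureL (map f ∣ x ∣) (f-simplicial _ (L-simplex x))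

        closedImage-mono : ∀ {x y} → ∣ x ∣ ⊆ ∣ y ∣ → ∣ closedImage x ∣ ⊆ ∣ closedImage y ∣
        closedImage-mono {x} {y} x⊆y =
          closure-least _ (closedImage y) (⊆-trans (map⁺ f x⊆y) (⊆-closure _))

    FixedSimplexProperty⇒FixedPointProperty : FixedSimplexProperty K → FixedPointProperty (L K)
    FixedSimplexProperty⇒FixedPointProperty fsp g g-mono =
      let σ , σ-simplex , _ , σ⊆fσ = fsp f f-simplicial
          τ = closureL σ σ-simplex
      in postfixed⇒fixed fsp g g-mono τ
           (closure-least σ-simplex (g τ) (⊆-trans σ⊆fσ (map-⊆ f (f-into τ ∘ ⊆-closure σ-simplex))))
      where
        vertexClosure : V → LCarrier K
        vertexClosure v = closureL (v ∷ []) (vertex v)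

        f : V → V
        f v = proj₁ (nonempty⇒∈ (proj₁ (proj₂ (g (vertexClosure v)))))

        f-into : ∀ x {v} → v ∈ ∣ x ∣ → f v ∈ ∣ g x ∣
        f-into x {v} v∈x =
          g-mono {vertexClosure v} {x} (closure-least (vertex v) x λ { (here refl) → v∈x })
            (proj₂ (nonempty⇒∈ (proj₁ (proj₂ (g (vertexClosure v))))))

        f-simplicial : IsSimplicialMap K f
        f-simplicial σ σ-simplex =
          let m , m-maximal , σ⊆m = esm σ σ-simplex
          in down-closed (L-simplex (g (maximal∈L m-maximal)))
                         (map-⊆ f (f-into (maximal∈L m-maximal) ∘ σ⊆m))
                         (map-nonempty f (nonempty σ-simplex))

proposition3p19 : ExcludedMiddle (lsuc 0ℓ) → (K : SimplicialComplex) →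
    EverySimplexInMaximal K →
    (FixedSimplexProperty K ⇔ FixedPointProperty (L K))
proposition3p19 em K esm =
  mk⇔ (FixedSimplexProperty⇒FixedPointProperty em₀ K esm) (FixedPointProperty⇒FixedSimplexProperty em₀ K esm)
  where em₀ = ExcludedMiddle-lower (lsuc 0ℓ) em
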